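{- Let $G$ be a finite $r$-regular simple graph and let $k$ be an integer with $k\le r$. If $|N(u)\cap N(v)|<k$ for every pair of distinct vertices $u\neq v$ of $G$, then $G$ is not $(k+2)$-warm, i.e. $w(G)\le k+1$, and hence $m(G)\le 2k+1$.
   Context: $N(u)$ denotes the set of vertices adjacent to $u$. A graph homomorphism $\phi:G\to H$ is a map $V(G)\to V(H)$ sending edges to edges; $\mathrm{Hom}(H,G)$ denotes the set of homomorphisms $H\to G$, made into a graph by joining two homomorphisms by an edge when they differ at exactly one vertex. For $d\ge 0$, $T^d$ is the infinite rooted tree in which the root has $d$ children and every other vertex also has exactly $d$ children. A map $\varphi\in\mathrm{Hom}(T^d,G)$ is called cold if there is a vertex $a$ of $G$ such that for every $k$ there is no $\psi\in\mathrm{Hom}(T^d,G)$ that agrees with $\varphi$ on all vertices at distance $k$ from the root $r$ and has $\psi(r)=a$. $G$ is $d$-warm if $\mathrm{Hom}(T^{d-2},G)$ contains no cold maps, and the warmth $w(G)$ is the largest $d$ for which $G$ is $d$-warm. $G$ is $d$-mobile if the graph $\mathrm{Hom}(H,G)$ is connected for every finite simple graph $H$ of maximum degree $d-2$; the mobility $m(G)$ is the largest $d$ for which $G$ is $d$-mobile. -}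

module Defs where

open import Data.Nat using (ℕ; zero; suc; _+_; _≤_; _<_)
open import Data.Bool using (Bool; true; false)
open import Data.Fin using (Fin)
open import Data.Fin.Subset using (Subset; _∩_; ∣_∣)
open import Data.Vec using (tabulate)
open import Data.List using (List; []; _∷_; length)
open import Data.Product using (Σ; ∃; _×_; _,_; proj₁)
open import Relation.Nullary using (¬_)
open import Relation.Binary.PropositionalEquality using (_≡_; _≢_)
open import Relation.Binary.Construct.Closure.ReflexiveTransitive using (Star)

record Graph (n : ℕ) : Set where
  field
    adj   : Fin n → Fin n → Bool
    sym   : ∀ u v → adj u v ≡ adj v u
    irrefl : ∀ u → adj u u ≡ false

open Graph public

N : ∀ {n} → Graph n → Fin n → Subset n
N G u = tabulate (λ v → adj G u v)

Regular : ∀ {n} → Graph n → ℕ → Set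
Regular G r = ∀ u → ∣ N G u ∣ ≡ r

Adj : ∀ {n} → Graph n → Fin n → Fin n → Set
Adj G u v = adj G u v ≡ true

-- The infinite rooted tree T^d: vertices are finite lists of child
-- indices (the path from the root), root = [], the parent of i ∷ xs is xs,
-- and the distance of xs from the root is length xs.

TreeVertex : ℕ → Set
TreeVertex d = List (Fin d)

TreeHom : ∀ {n} → ℕ → Graph n → Set
TreeHom {n} d G =
  Σ (TreeVertex d → Fin n) λ φ → ∀ (xs : TreeVertex d) (i : Fin d) → Adj G (φ xs) (φ (i ∷ xs))

Cold : ∀ {n} {d} (G : Graph n) → TreeHom d G → Set
Cold {n} {d} G φ =
  ∃ λ (a : Fin n) → ∀ (k : ℕ) →
    ¬ (Σ (TreeHom d G) λ ψ →
         (∀ (xs : TreeVertex d) → length xs ≡ k → proj₁ ψ xs ≡ proj₁ φ xs)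
         × proj₁ ψ [] ≡ a)

Warm : ∀ {n} → Graph n → ℕ → Set
Warm G d = ∀ (t : ℕ) → t + 2 ≡ d → ∀ (φ : TreeHom t G) → ¬ Cold G φ

Hom : ∀ {h n} → Graph h → Graph n → Set
Hom {h} {n} H G = Σ (Fin h → Fin n) λ φ → ∀ x y → Adj H x y → Adj G (φ x) (φ y)

HomEdge : ∀ {h n} (H : Graph h) (G : Graph n) → Hom H G → Hom H G → Set
HomEdge {h} H G (φ , _) (ψ , _) = ∃ λ (v : Fin h) → φ v ≢ ψ v × (∀ w → w ≢ v → φ w ≡ ψ w)

HomConnected : ∀ {h n} → Graph h → Graph n → Set
HomConnected H G = ∀ (φ ψ : Hom H G) → Star (HomEdge H G) φ ψ

MaxDegPlus2≤ : ∀ {h} → Graph h → ℕ → Set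
MaxDegPlus2≤ H d = ∀ u → ∣ N H u ∣ + 2 ≤ d

Mobile : ∀ {n} → Graph n → ℕ → Set
Mobile G d = ∀ (h : ℕ) (H : Graph h) → MaxDegPlus2≤ H d → HomConnected H G

module Submission where

-- If distinct vertices share fewer than k neighbours, a vertex is determined by any k distinct
-- neighbours of it; so a homomorphism into G cannot be changed at a single vertex x of the source
-- as long as k neighbours of x with distinct images stay put.
--
-- Warmth: map T^k into G so that the children of each tree vertex go to k distinct neighbours of
-- its image. A homomorphism agreeing with this map on level K then agrees with it on all levels
-- above K, in particular at the root, so the map is cold.
--
-- Mobility: order each neighbourhood and cut the positions 0, …, r−1 into ⌊r/k⌋ blocks of k
-- consecutive positions, the last block also taking the remainder (so it has fewer than 2k).
-- Let H have vertices (u, b, j), b a side of a bipartite double cover and j a block, with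
-- (u, b, j) ~ (v, c, l) when uv is an edge, b ≠ c, v is in block j of N(u) and u in block l of
-- N(v). Then H has maximum degree at most 2k and the projection H → G is isolated in Hom(H, G),
-- yet H, being bipartite, also maps onto a single edge of G.

open import Defs hiding (sym)
open import Data.Nat using (ℕ; zero; suc; _+_; _*_; _∸_; _⊓_; _≤_; _<_; s≤s; s≤s⁻¹; z<s; s<s; NonZero)
open import Data.Nat.Properties
  using ( suc-injective; +-comm; +-suc; +-identityʳ; *-distribʳ-+; +-cancelˡ-≡; m+n∸m≡n
        ; ≤-trans; <-trans; <-≤-trans; <⇒≱; n≤1+n; +-monoˡ-≤; +-monoˡ-<; +-monoʳ-<; *-monoˡ-≤
        ; ∸-monoˡ-<; ∸-cancelʳ-≡; m⊓n≤m; m⊓n≤n; ⊓-glb; m≤n⇒m⊓n≡m; module ≤-Reasoning)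
open import Data.Nat.DivMod
  using ( _/_; _%_; m≡m%n+[m/n]*n; m%n<n; m/n*n≤m; m*n/n≡m; m<n⇒m/n≡0; m≥n⇒m/n>0
        ; m<n*o⇒m/o<n; +-distrib-/-∣ˡ)
open import Data.Nat.Divisibility using (n∣m*n)
open import Data.Bool using (Bool; true; false; not)
import Data.Bool as Bool
open import Data.Bool.Properties using (¬-not; not-¬)
open import Data.Fin using (Fin; zero; suc; toℕ; fromℕ<; _≟_)
open import Data.Fin.Properties
  using (toℕ-fromℕ<; fromℕ<-injective; toℕ<n; toℕ-injective; injective⇒≤; *↔×; 2↔Bool)
open import Data.Fin.Subset using (Subset; inside; outside; _∈_; _∩_; ∣_∣)
open import Data.Fin.Subset.Properties using (x∈p∩q⁺)
open import Data.Vec using (_∷_; here; there)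
open import Data.Vec.Properties using (lookup∘tabulate; []=⇒lookup; lookup⇒[]=)
open import Data.List using ([]; _∷_; length)
open import Data.Product using (∃; _×_; _,_; proj₁; proj₂)
open import Data.Product.Function.NonDependent.Propositional using (_×-↔_)
open import Function using (Injective; _∘_; _↔_; Inverse; Injection)
open import Function.Bundles using (mk⇔)
open import Function.Properties.Inverse using (↔-refl; ↔-trans; ↔⇒↣)
open import Relation.Binary using (Decidable; Symmetric)
open import Relation.Nullary using (¬_; does; yes; no; contradiction; _×-dec_; ¬?)
open import Relation.Nullary.Decidable using (dec-true; dec-false; does-⇔)
open import Relation.Binary.PropositionalEquality
  using (_≡_; _≢_; refl; sym; trans; cong; cong₂; subst; module ≡-Reasoning)
open import Relation.Binary.Construct.Closure.ReflexiveTransitive using (ε; _◅_)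

rank : ∀ {n} → Subset n → Fin n → ℕ
rank (_       ∷ p) zero    = 0
rank (inside  ∷ p) (suc x) = suc (rank p x)
rank (outside ∷ p) (suc x) = rank p x

rank-< : ∀ {n} {p : Subset n} {x} → x ∈ p → rank p x < ∣ p ∣
rank-< here = z<s
rank-< {p = inside  ∷ p} (there x∈p) = s<s (rank-< x∈p)
rank-< {p = outside ∷ p} (there x∈p) = rank-< x∈p

rank-injective : ∀ {n} {p : Subset n} {x y} → x ∈ p → y ∈ p → rank p x ≡ rank p y → x ≡ y
rank-injective here here _ = refl
rank-injective {p = inside  ∷ p} (there x∈p) (there y∈p) eq =
  cong suc (rank-injective x∈p y∈p (suc-injective eq))
rank-injective {p = outside ∷ p} (there x∈p) (there y∈p) eq = cong suc (rank-injective x∈p y∈p eq)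

select : ∀ {n} (p : Subset n) {t} → t < ∣ p ∣ → Fin n
select (inside  ∷ p) {zero}  _         = zero
select (inside  ∷ p) {suc t} (s<s t<∣p∣) = suc (select p t<∣p∣)
select (outside ∷ p)         t<∣p∣       = suc (select p t<∣p∣)

select-∈ : ∀ {n} (p : Subset n) {t} (t<∣p∣ : t < ∣ p ∣) → select p t<∣p∣ ∈ p
select-∈ (inside  ∷ p) {zero}  _           = here
select-∈ (inside  ∷ p) {suc t} (s<s t<∣p∣) = there (select-∈ p t<∣p∣)
select-∈ (outside ∷ p)         t<∣p∣       = there (select-∈ p t<∣p∣)

rank-select : ∀ {n} (p : Subset n) {t} (t<∣p∣ : t < ∣ p ∣) → rank p (select p t<∣p∣) ≡ t
rank-select (inside  ∷ p) {zero}  _           = refl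
rank-select (inside  ∷ p) {suc t} (s<s t<∣p∣) = cong suc (rank-select p t<∣p∣)
rank-select (outside ∷ p)         t<∣p∣       = rank-select p t<∣p∣

Fin↣p⇒c≤∣p∣ : ∀ {n c} {p : Subset n} (g : Fin c → Fin n) →
              Injective _≡_ _≡_ g → (∀ s → g s ∈ p) → c ≤ ∣ p ∣
Fin↣p⇒c≤∣p∣ {c = c} {p} g g-injective g∈p = injective⇒≤ {f = index} index-injective
  where
  index : Fin c → Fin ∣ p ∣
  index s = fromℕ< (rank-< (g∈p s))
  index-injective : Injective _≡_ _≡_ index
  index-injective {s} {s′} eq = g-injective (rank-injective (g∈p s) (g∈p s′)
    (fromℕ<-injective _ _ _ _ eq))

p↣Fin⇒∣p∣≤c : ∀ {n c} {p : Subset n} (h : Fin n → ℕ) → (∀ {x} → x ∈ p → h x < c) →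
              (∀ {x y} → x ∈ p → y ∈ p → h x ≡ h y → x ≡ y) → ∣ p ∣ ≤ c
p↣Fin⇒∣p∣≤c {c = c} {p} h h<c h-injective = injective⇒≤ {f = code} code-injective
  where
  code : Fin ∣ p ∣ → Fin c
  code t = fromℕ< (h<c (select-∈ p (toℕ<n t)))
  code-injective : Injective _≡_ _≡_ code
  code-injective {t} {t′} eq = toℕ-injective (begin
    toℕ t                         ≡⟨ sym (rank-select p (toℕ<n t)) ⟩
    rank p (select p (toℕ<n t))   ≡⟨ cong (rank p) same-element ⟩
    rank p (select p (toℕ<n t′))  ≡⟨ rank-select p (toℕ<n t′) ⟩
    toℕ t′                        ∎)
    where
    open ≡-Reasoning
    same-element : select p (toℕ<n t) ≡ select p (toℕ<n t′)
    same-element = h-injective (select-∈ p _) (select-∈ p _)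
      (fromℕ<-injective _ _ _ _ eq)

m<[1+m/n]*n : ∀ m n .{{_ : NonZero n}} → m < suc (m / n) * n
m<[1+m/n]*n m n = begin-strict
  m                 ≡⟨ m≡m%n+[m/n]*n m n ⟩
  m % n + m / n * n <⟨ +-monoˡ-< (m / n * n) (m%n<n m n) ⟩
  n + m / n * n     ∎
  where open ≤-Reasoning

positive-quotient : ∀ {r k} .{{_ : NonZero k}} → k ≤ r → ∃ λ q → suc q * k ≤ r × r < suc (suc q) * k
positive-quotient {r} {k} k≤r with r / k | m≥n⇒m/n>0 k≤r | m/n*n≤m r k | m<[1+m/n]*n r k
... | suc q | _ | [1+q]k≤r | r<[2+q]k = q , [1+q]k≤r , r<[2+q]k

module Blocks (k q : ℕ) .{{_ : NonZero k}} where

  block : ℕ → Fin (suc q)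
  block t = fromℕ< (s≤s (m⊓n≤n (t / k) q))

  block-start : ∀ (j : Fin (suc q)) {i} → i < k → block (toℕ j * k + i) ≡ j
  block-start j {i} i<k = toℕ-injective (begin
    toℕ (block (toℕ j * k + i))   ≡⟨ toℕ-fromℕ< _ ⟩
    (toℕ j * k + i) / k ⊓ q       ≡⟨ cong (_⊓ q) (+-distrib-/-∣ˡ i (n∣m*n (toℕ j))) ⟩
    (toℕ j * k / k + i / k) ⊓ q   ≡⟨ cong₂ (λ a b → (a + b) ⊓ q) (m*n/n≡m (toℕ j) k) (m<n⇒m/n≡0 i<k) ⟩
    (toℕ j + 0) ⊓ q               ≡⟨ cong (_⊓ q) (+-identityʳ (toℕ j)) ⟩
    toℕ j ⊓ q                     ≡⟨ m≤n⇒m⊓n≡m (s≤s⁻¹ (toℕ<n j)) ⟩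
    toℕ j                         ∎)
    where open ≡-Reasoning

  block-range : ∀ {t} (j : Fin (suc q)) → t < suc (suc q) * k → block t ≡ j →
                toℕ j * k ≤ t × t < toℕ j * k + 2 * k
  block-range {t} j t<[2+q]k block-t≡j = lower , upper
    where
    open ≤-Reasoning
    index : toℕ j ≡ t / k ⊓ q
    index = trans (cong toℕ (sym block-t≡j)) (toℕ-fromℕ< _)
    lower : toℕ j * k ≤ t
    lower = begin
      toℕ j * k       ≡⟨ cong (_* k) index ⟩
      (t / k ⊓ q) * k ≤⟨ *-monoˡ-≤ k (m⊓n≤m (t / k) q) ⟩
      t / k * k       ≤⟨ m/n*n≤m t k ⟩
      t               ∎
    upper : t < toℕ j * k + 2 * k
    upper = begin-strict
      t                        <⟨ m<[1+m/n]*n t k ⟩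
      suc (t / k) * k          ≤⟨ *-monoˡ-≤ k (s≤s (⊓-glb (n≤1+n (t / k)) (s≤s⁻¹ (m<n*o⇒m/o<n t<[2+q]k)))) ⟩
      suc (suc (t / k ⊓ q)) * k ≡⟨ cong (λ J → suc (suc J) * k) (sym index) ⟩
      (2 + toℕ j) * k          ≡⟨ *-distribʳ-+ k 2 (toℕ j) ⟩
      2 * k + toℕ j * k        ≡⟨ +-comm (2 * k) (toℕ j * k) ⟩
      toℕ j * k + 2 * k        ∎

module _ {n} (G : Graph n) {u v : Fin n} where

  Adj⇒∈N : Adj G u v → v ∈ N G u
  Adj⇒∈N u~v = lookup⇒[]= v (N G u) (trans (lookup∘tabulate _ v) u~v)

  ∈N⇒Adj : v ∈ N G u → Adj G u v
  ∈N⇒Adj v∈Nu = trans (sym (lookup∘tabulate _ v)) ([]=⇒lookup v∈Nu)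

  Adj⇒≢ : Adj G u v → u ≢ v
  Adj⇒≢ u~v refl with trans (sym u~v) (irrefl G u)
  ... | ()

isolated⇒¬connected : ∀ {h n} {H : Graph h} {G : Graph n} {φ ψ : Hom H G} →
  (∀ χ → ¬ HomEdge H G φ χ) → ∀ x → proj₁ φ x ≢ proj₁ ψ x → ¬ HomConnected H G
isolated⇒¬connected {φ = φ} {ψ} isolated x φx≢ψx connected with connected φ ψ
... | ε     = φx≢ψx refl
... | _◅_ {j = χ} e _ = isolated χ e

module FewCommonNeighbours {n} (G : Graph n) {k}
  (few-common : ∀ u v → u ≢ v → ∣ N G u ∩ N G v ∣ < k) where

  common-neighbours⇒≡ : ∀ {u w} (g : Fin k → Fin n) → Injective _≡_ _≡_ g →
                        (∀ s → Adj G u (g s)) → (∀ s → Adj G w (g s)) → u ≡ w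
  common-neighbours⇒≡ {u} {w} g g-injective u~g w~g with u ≟ w
  ... | yes u≡w = u≡w
  ... | no  u≢w = contradiction
    (Fin↣p⇒c≤∣p∣ g g-injective (λ s → x∈p∩q⁺ (Adj⇒∈N G (u~g s) , Adj⇒∈N G (w~g s))))
    (<⇒≱ (few-common u w u≢w))

  homomorphism-isolated : ∀ {h} (H : Graph h) (φ : Hom H G) →
    (∀ x → ∃ λ (g : Fin k → Fin h) → Injective _≡_ _≡_ (proj₁ φ ∘ g) × (∀ s → Adj H x (g s))) →
    ∀ χ → ¬ HomEdge H G φ χ
  homomorphism-isolated H (φ , φ-hom) spread (χ , χ-hom) (v , φv≢χv , agree)
    with g , φ∘g-injective , v~g ← spread v =
    φv≢χv (common-neighbours⇒≡ (φ ∘ g) φ∘g-injective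
      (λ s → φ-hom v (g s) (v~g s))
      (λ s → subst (Adj G (χ v)) (sym (agree (g s) (Adj⇒≢ H (v~g s) ∘ sym))) (χ-hom v (g s) (v~g s))))

  module _ (nbr : Fin n → Fin k → Fin n) (nbr-injective : ∀ u → Injective _≡_ _≡_ (nbr u))
           (nbr-adj : ∀ u i → Adj G u (nbr u i)) where

    unfold : Fin n → TreeVertex k → Fin n
    unfold x []       = x
    unfold x (i ∷ xs) = nbr (unfold x xs) i

    unfoldHom : Fin n → TreeHom k G
    unfoldHom x = unfold x , λ xs i → nbr-adj (unfold x xs) i

    level-determines-root : ∀ {x K} (ψ : TreeHom k G) →
                            (∀ xs → length xs ≡ K → proj₁ ψ xs ≡ unfold x xs) → proj₁ ψ [] ≡ x
    level-determines-root {x} {K} (ψ , ψ-hom) agree = above K [] refl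
      where
      above : ∀ j xs → length xs + j ≡ K → ψ xs ≡ unfold x xs
      above zero    xs eq = agree xs (trans (sym (+-identityʳ _)) eq)
      above (suc j) xs eq = sym (common-neighbours⇒≡ (nbr (unfold x xs)) (nbr-injective _)
        (nbr-adj _)
        (λ i → subst (Adj G (ψ xs)) (above j (i ∷ xs) (trans (sym (+-suc _ j)) eq)) (ψ-hom xs i)))

    ¬Warm : Fin n → Fin k → ¬ Warm G (k + 2)
    ¬Warm x i warm = warm k refl (unfoldHom x) (nbr x i , cold)
      where
      cold : ∀ K → ¬ (∃ λ (ψ : TreeHom k G) →
               (∀ xs → length xs ≡ K → proj₁ ψ xs ≡ unfold x xs) × proj₁ ψ [] ≡ nbr x i)
      cold K (ψ , agree , ψ[]≡nbr) =
        Adj⇒≢ G (nbr-adj x i) (trans (sym (level-determines-root ψ agree)) ψ[]≡nbr)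

module CodedGraph {h} {V : Set} (code : Fin h ↔ V) {E : V → V → Set} (E? : Decidable E)
                  (E-sym : Symmetric E) (E-irrefl : ∀ x → ¬ E x x) where
  open Inverse code

  graph : Graph h
  graph = record
    { adj    = λ a c → does (E? (to a) (to c))
    ; sym    = λ a c → does-⇔ (mk⇔ E-sym E-sym) (E? _ _) (E? _ _)
    ; irrefl = λ a → dec-false (E? _ _) (E-irrefl (to a))
    }

  Adj⇒E : ∀ {a c} → Adj graph a c → E (to a) (to c)
  Adj⇒E {a} {c} a~c with E? (to a) (to c) | a~c
  ... | yes e | _  = e
  ... | no  _ | ()

  E⇒Adj : ∀ {a y} → E (to a) y → Adj graph a (from y)
  E⇒Adj {y = y} e = dec-true (E? _ _) (subst (E _) (sym (strictlyInverseˡ y)) e)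

module RegularNeighbours {n} (G : Graph n) {r} (regular : Regular G r) where

  position : Fin n → Fin n → ℕ
  position u = rank (N G u)

  position-< : ∀ {u v} → Adj G u v → position u v < r
  position-< {u} u~v = subst (_ <_) (regular u) (rank-< (Adj⇒∈N G u~v))

  neighbour : ∀ (u : Fin n) {t} → t < r → Fin n
  neighbour u {t} t<r = select (N G u) (subst (t <_) (sym (regular u)) t<r)

  neighbour-adj : ∀ u {t} (t<r : t < r) → Adj G u (neighbour u t<r)
  neighbour-adj u t<r = ∈N⇒Adj G (select-∈ (N G u) _)

  position-neighbour : ∀ u {t} (t<r : t < r) → position u (neighbour u t<r) ≡ t
  position-neighbour u t<r = rank-select (N G u) _

  neighbour-injective : ∀ u {t t′} (t<r : t < r) (t′<r : t′ < r) →
                        neighbour u t<r ≡ neighbour u t′<r → t ≡ t′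
  neighbour-injective u {t} {t′} t<r t′<r eq = begin
    t                              ≡⟨ position-neighbour u t<r ⟨
    position u (neighbour u t<r)   ≡⟨ cong (position u) eq ⟩
    position u (neighbour u t′<r)  ≡⟨ position-neighbour u t′<r ⟩
    t′                             ∎
    where open ≡-Reasoning

  module _ {k} (k≤r : k ≤ r) where

    firstNeighbours : Fin n → Fin k → Fin n
    firstNeighbours u i = neighbour u (<-≤-trans (toℕ<n i) k≤r)

    firstNeighbours-adj : ∀ u i → Adj G u (firstNeighbours u i)
    firstNeighbours-adj u i = neighbour-adj u _

    firstNeighbours-injective : ∀ u → Injective _≡_ _≡_ (firstNeighbours u)
    firstNeighbours-injective u eq = toℕ-injective (neighbour-injective u _ _ eq)

module BlockCover {n} (G : Graph n) {r} (regular : Regular G r) {k}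
  (few-common : ∀ u v → u ≢ v → ∣ N G u ∩ N G v ∣ < k)
  (q : ℕ) .{{_ : NonZero k}} ([1+q]k≤r : suc q * k ≤ r) (r<[2+q]k : r < suc (suc q) * k) where

  open RegularNeighbours G regular
  open Blocks k q
  open FewCommonNeighbours G few-common

  Vertex : Set
  Vertex = Fin n × Bool × Fin (suc q)

  Edge : Vertex → Vertex → Set
  Edge (u , b , j) (v , c , l) =
    Adj G u v × b ≢ c × block (position u v) ≡ j × block (position v u) ≡ l

  edge? : Decidable Edge
  edge? (u , b , j) (v , c , l) =
    (adj G u v Bool.≟ true) ×-dec ¬? (b Bool.≟ c) ×-dec
    (block (position u v) ≟ j) ×-dec (block (position v u) ≟ l)

  edge-sym : Symmetric Edge
  edge-sym {u , _} {v , _} (u~v , b≢c , j , l) = trans (Graph.sym G v u) u~v , b≢c ∘ sym , l , j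

  edge-irrefl : ∀ x → ¬ Edge x x
  edge-irrefl x (_ , b≢b , _) = b≢b refl

  code : Fin (n * (2 * suc q)) ↔ Vertex
  code = ↔-trans *↔× (↔-refl ×-↔ ↔-trans *↔× (2↔Bool ×-↔ ↔-refl))

  open CodedGraph code edge? edge-sym edge-irrefl renaming (graph to H)
  open Inverse code using (to; from; strictlyInverseˡ)

  projection : Hom H G
  projection = proj₁ ∘ to , λ a c a~c → proj₁ (Adj⇒E a~c)

  module _ {x₀ y₀ : Fin n} (x₀~y₀ : Adj G x₀ y₀) where

    side : Bool → Fin n
    side false = x₀
    side true  = y₀

    side-adj : ∀ b → Adj G (side b) (side (not b))
    side-adj false = x₀~y₀
    side-adj true  = trans (Graph.sym G y₀ x₀) x₀~y₀

    sideHom : Hom H G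
    sideHom = side ∘ proj₁ ∘ proj₂ ∘ to , λ a c a~c →
      subst (Adj G _) (cong side (sym (¬-not (proj₁ (proj₂ (Adj⇒E a~c)) ∘ sym)))) (side-adj _)

    x̂₀ : Vertex
    x̂₀ = x₀ , true , zero

    projection≢sideHom : proj₁ projection (from x̂₀) ≢ proj₁ sideHom (from x̂₀)
    projection≢sideHom eq = Adj⇒≢ G x₀~y₀ (begin
      x₀                                  ≡⟨ cong proj₁ (strictlyInverseˡ x̂₀) ⟨
      proj₁ (to (from x̂₀))                ≡⟨ eq ⟩
      side (proj₁ (proj₂ (to (from x̂₀)))) ≡⟨ cong (side ∘ proj₁ ∘ proj₂) (strictlyInverseˡ x̂₀) ⟩
      y₀                                  ∎)
      where open ≡-Reasoning

  start-< : ∀ (j : Fin (suc q)) (i : Fin k) → toℕ j * k + toℕ i < r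
  start-< j i = begin-strict
    toℕ j * k + toℕ i  <⟨ +-monoʳ-< (toℕ j * k) (toℕ<n i) ⟩
    toℕ j * k + k      ≡⟨ +-comm (toℕ j * k) k ⟩
    suc (toℕ j) * k    ≤⟨ *-monoˡ-≤ k (toℕ<n j) ⟩
    suc q * k          ≤⟨ [1+q]k≤r ⟩
    r                  ∎
    where open ≤-Reasoning

  step : Vertex → Fin k → Vertex
  step (u , b , j) i = v , not b , block (position v u)
    where v = neighbour u (start-< j i)

  edge-step : ∀ x i → Edge x (step x i)
  edge-step (u , b , j) i =
    neighbour-adj u _ , not-¬ refl ,
    trans (cong block (position-neighbour u (start-< j i))) (block-start j (toℕ<n i)) , refl

  step-injective : ∀ x → Injective _≡_ _≡_ (proj₁ ∘ step x)
  step-injective (u , b , j) eq =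
    toℕ-injective (+-cancelˡ-≡ (toℕ j * k) _ _ (neighbour-injective u _ _ eq))

  projection-spread : ∀ a → ∃ λ (g : Fin k → Fin (n * (2 * suc q))) →
    Injective _≡_ _≡_ (proj₁ projection ∘ g) × (∀ s → Adj H a (g s))
  projection-spread a = from ∘ step (to a) , injective , λ s → E⇒Adj (edge-step (to a) s)
    where
    injective : Injective _≡_ _≡_ (proj₁ projection ∘ from ∘ step (to a))
    injective {s} {s′} eq = step-injective (to a) (begin
      proj₁ (step (to a) s)              ≡⟨ cong proj₁ (strictlyInverseˡ (step (to a) s)) ⟨
      proj₁ (to (from (step (to a) s)))  ≡⟨ eq ⟩
      proj₁ (to (from (step (to a) s′))) ≡⟨ cong proj₁ (strictlyInverseˡ (step (to a) s′)) ⟩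
      proj₁ (step (to a) s′)             ∎)
      where open ≡-Reasoning

  neighbours-determined : ∀ {a c c′} → Adj H a c → Adj H a c′ → proj₁ (to c) ≡ proj₁ (to c′) → c ≡ c′
  neighbours-determined {a} {c} {c′} a~c a~c′ v≡v′
    with (_ , b≢c , _ , l) ← Adj⇒E a~c | (_ , b≢c′ , _ , l′) ← Adj⇒E a~c′ =
    Injection.injective (↔⇒↣ code) (cong₂ _,_ v≡v′ (cong₂ _,_ layers blocks))
    where
    layers : proj₁ (proj₂ (to c)) ≡ proj₁ (proj₂ (to c′))
    layers = trans (¬-not (b≢c ∘ sym)) (sym (¬-not (b≢c′ ∘ sym)))
    blocks : proj₂ (proj₂ (to c)) ≡ proj₂ (proj₂ (to c′))
    blocks = trans (sym l) (trans (cong (λ v → block (position v (proj₁ (to a)))) v≡v′) l′)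

  degree-≤ : ∀ a → ∣ N H a ∣ ≤ 2 * k
  degree-≤ a = p↣Fin⇒∣p∣≤c offset offset-< offset-injective
    where
    u : Fin n
    u = proj₁ (to a)
    J : ℕ
    J = toℕ (proj₂ (proj₂ (to a))) * k
    offset : Fin (n * (2 * suc q)) → ℕ
    offset c = position u (proj₁ (to c)) ∸ J
    in-block : ∀ {c} → c ∈ N H a →
               J ≤ position u (proj₁ (to c)) × position u (proj₁ (to c)) < J + 2 * k
    in-block c∈Na with (u~v , _ , block≡j , _) ← Adj⇒E (∈N⇒Adj H c∈Na) =
      block-range _ (<-trans (position-< u~v) r<[2+q]k) block≡j
    offset-< : ∀ {c} → c ∈ N H a → offset c < 2 * k
    offset-< {c} c∈Na with (lower , upper) ← in-block c∈Na =
      subst (offset c <_) (m+n∸m≡n J (2 * k)) (∸-monoˡ-< upper lower)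
    offset-injective : ∀ {c c′} → c ∈ N H a → c′ ∈ N H a → offset c ≡ offset c′ → c ≡ c′
    offset-injective {c} {c′} c∈Na c′∈Na eq = neighbours-determined a~c a~c′
      (rank-injective (Adj⇒∈N G (proj₁ (Adj⇒E a~c))) (Adj⇒∈N G (proj₁ (Adj⇒E a~c′)))
        (∸-cancelʳ-≡ (proj₁ (in-block c∈Na)) (proj₁ (in-block c′∈Na)) eq))
      where
      a~c : Adj H a c
      a~c = ∈N⇒Adj H c∈Na
      a~c′ : Adj H a c′
      a~c′ = ∈N⇒Adj H c′∈Na

  ¬Mobile : ∀ {x₀ y₀} → Adj G x₀ y₀ → ∀ d → 2 * k + 2 ≤ d → ¬ Mobile G d
  ¬Mobile x₀~y₀ d 2k+2≤d mobile =
    isolated⇒¬connected {H = H} {G = G} {φ = projection} {ψ = sideHom x₀~y₀}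
      (homomorphism-isolated H projection projection-spread) (from (x̂₀ x₀~y₀)) (projection≢sideHom x₀~y₀)
      (mobile _ H (λ a → ≤-trans (+-monoˡ-≤ 2 (degree-≤ a)) 2k+2≤d))

lemma6p3 : ∀ (m : ℕ) (G : Graph (suc m)) (r k : ℕ) →
    Regular G r → 1 ≤ k → k ≤ r →
    (∀ (u v : Fin (suc m)) → u ≢ v → ∣ N G u ∩ N G v ∣ < k) →
    ¬ Warm G (k + 2) × (∀ (d : ℕ) → 2 * k + 2 ≤ d → ¬ Mobile G d)
lemma6p3 m G r k@(suc _) regular _ k≤r few-common
  with q , [1+q]k≤r , r<[2+q]k ← positive-quotient k≤r =
  ¬Warm (firstNeighbours k≤r) (firstNeighbours-injective k≤r) (firstNeighbours-adj k≤r) zero zero ,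
  BlockCover.¬Mobile G regular few-common q [1+q]k≤r r<[2+q]k (firstNeighbours-adj k≤r zero zero)
  where
  open FewCommonNeighbours G few-common
  open RegularNeighbours G regular
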